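{- Let $\mathbf D$ be a $k$-ary domain-independent disjunctive embedded dependency, let $A$ be a set, $R\subseteq A^k$, $B\supseteq A$, $n\ge1$, and for each $q\in\mathbb N$ let $\vec b^{(q)}_1,\dots,\vec b^{(q)}_n\in B^k\setminus A^k$ be $k$-tuples. Let $\vec a$ list the elements of $A\cap\bigcup_{i=1}^n\mathrm{Rng}(\vec b^{(1)}_i)$, and assume: (1) every $\vec b^{(q)}_i$ is disjoint from $A$ except on $\vec a$; (2) whenever $q\ne q'$, the concatenated tuples $\vec b^{(q)}_1\cdots\vec b^{(q)}_n$ and $\vec b^{(q')}_1\cdots\vec b^{(q')}_n$ are disjoint except on $\vec a$; (3) the identity type of $\vec b^{(q)}_1\cdots\vec b^{(q)}_n\vec a$ is the same for all $q\in\mathbb N$. Suppose furthermore that $(B,S)\in\mathbf D$ for some $S$ with $R\subseteq S\subseteq R\cup\bigcup_{q\in\mathbb N}\{\vec b^{(q)}_1,\dots,\vec b^{(q)}_n\}$, and that $\{\vec b^{(q)}_i: q\in Q,1\le i\le n\}\subseteq S$ for some nonempty $Q\subseteq\mathbb N$. Then $(B,R\cup\{\vec b^{(q)}_i:q\in Q,1\le i\le n\})\in\mathbf D$.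
   Context: For a tuple $\vec c=c_1\dots c_n$, $\mathrm{Rng}(\vec c)=\{c_1,\dots,c_n\}$; a tuple lists a finite set if it has no repetitions and its range is that set. A tuple $\vec b$ is disjoint from a set $A$ except on $\vec a$ if $\mathrm{Rng}(\vec b)\cap A\subseteq\mathrm{Rng}(\vec a)$; tuples $\vec b,\vec b'$ are disjoint except on $\vec a$ if $\mathrm{Rng}(\vec b)\cap\mathrm{Rng}(\vec b')\subseteq\mathrm{Rng}(\vec a)$. The identity type of $\vec c$ is $\tau(x_1,\dots,x_n)=\bigwedge_{c_i=c_j}x_i=x_j\wedge\bigwedge_{c_i\ne c_j}x_i\ne x_j$. A (unirelational) disjunctive embedded dependency over a $k$-ary relation symbol $R$ is a first-order sentence $\mathbf D(R)$ of the form $\forall \vec x\,(\phi(\vec x)\to\bigvee_{i=1}^m\exists\vec y^{(i)}\psi_i(\vec x,\vec y^{(i)}))$, where $\phi$ and all $\psi_i$ are conjunctions of atoms $R\vec z$ and $z=w$; it is identified with the class of structures $(M,R)$ satisfying it. It is domain-independent if for all sets $M,N$ and all $R\subseteq M^k\cap N^k$: $(M,R)\in\mathbf D\iff(N,R)\in\mathbf D$. -}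

module Defs where

open import Data.Nat using (ℕ; zero; suc; _*_)
open import Data.Fin using (Fin)
open import Data.Vec using (Vec; lookup; concat; _++_)
open import Data.List using (List)
open import Data.List.Relation.Unary.All using (All)
open import Data.List.Relation.Unary.Any using (Any)
open import Data.Product using (Σ; ∃; _×_)
open import Data.Sum using (_⊎_)
open import Relation.Binary.PropositionalEquality using (_≡_)
open import Relation.Nullary using (¬_)
open import Function.Bundles using (_⇔_)

data Atom (k : ℕ) (V : Set) : Set where
  rel : Vec V k → Atom k V
  eq  : V → V → Atom k V

-- One disjunct  ∃ y⃗ ψ(x⃗, y⃗)  with ny existential variables;
-- ψ is a conjunction (list) of atoms over the variables x⃗ (inj₁) and y⃗ (inj₂).
record Disjunct (k nx : ℕ) : Set where
  field
    ny  : ℕ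
    psi : List (Atom k (Fin nx ⊎ Fin ny))

-- ∀ x⃗ (φ(x⃗) → ⋁_i ∃ y⃗⁽ⁱ⁾ ψ_i(x⃗, y⃗⁽ⁱ⁾)),  with nx universal variables.
record DED (k : ℕ) : Set where
  field
    nx    : ℕ
    phi   : List (Atom k (Fin nx))
    heads : List (Disjunct k nx)

-- Semantics.  Sets are subsets (predicates) of an ambient type U;
-- a structure (M , R) consists of a domain M ⊆ U and R ⊆ U^k.

Pred : Set → Set₁
Pred X = X → Set

HoldsAtom : {k : ℕ} {U V : Set} → Pred (Vec U k) → (V → U) → Atom k V → Set
HoldsAtom R s (rel z) = R (Data.Vec.map s z)
HoldsAtom R s (eq z w) = s z ≡ s w

HoldsConj : {k : ℕ} {U V : Set} → Pred (Vec U k) → (V → U) → List (Atom k V) → Set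
HoldsConj R s as = All (HoldsAtom R s) as

[_,_] : {nx ny : ℕ} {U : Set} → (Fin nx → U) → (Fin ny → U) → (Fin nx ⊎ Fin ny → U)
[ f , g ] = Data.Sum.[ f , g ]

Sat : {k : ℕ} (U : Set) → Pred U → Pred (Vec U k) → DED k → Set
Sat U M R D =
  (x : Fin (DED.nx D) → U) → (∀ i → M (x i)) →
  HoldsConj R x (DED.phi D) →
  Any (λ d → Σ (Fin (Disjunct.ny d) → U) λ y → (∀ j → M (y j)) ×
               HoldsConj R [ x , y ] (Disjunct.psi d))
      (DED.heads D)

DomainIndependent : {k : ℕ} → DED k → Set₁
DomainIndependent {k} D =
  (U : Set) (M N : Pred U) (R : Pred (Vec U k)) →
  (∀ t → R t → ∀ j → M (lookup t j)) →
  (∀ t → R t → ∀ j → N (lookup t j)) →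
  Sat U M R D ⇔ Sat U N R D

Rng : {U : Set} {n : ℕ} → Vec U n → Pred U
Rng c u = ∃ λ i → lookup c i ≡ u

Lists : {U : Set} {n : ℕ} → Vec U n → Pred U → Set
Lists c P = (∀ i j → lookup c i ≡ lookup c j → i ≡ j) × (∀ u → Rng c u ⇔ P u)

DisjointFromExceptOn : {U : Set} {n m : ℕ} → Vec U n → Pred U → Vec U m → Set
DisjointFromExceptOn b A a = ∀ u → Rng b u → A u → Rng a u

DisjointExceptOn : {U : Set} {n n' m : ℕ} → Vec U n → Vec U n' → Vec U m → Set
DisjointExceptOn b b' a = ∀ u → Rng b u → Rng b' u → Rng a u

SameIdType : {U : Set} {n : ℕ} → Vec U n → Vec U n → Set
SameIdType c c' = ∀ i j → (lookup c i ≡ lookup c j) ⇔ (lookup c' i ≡ lookup c' j)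

AddTuples : {U : Set} {k n : ℕ} → Pred (Vec U k) → (ℕ → Vec (Vec U k) n) → Pred ℕ → Pred (Vec U k)
AddTuples R b Q t = R t ⊎ (∃ λ q → Q q × ∃ λ i → t ≡ lookup (b q) i)

Allℕ : Pred ℕ
Allℕ _ = Data.Unit.⊤
  where import Data.Unit

{-# OPTIONS --safe #-}
-- Every tuple of S has its entries in A ∪ ⋃_q Rng(b⁽q⁾), and every tuple of
-- T = R ∪ {b⁽q⁾ᵢ : q ∈ Q} in A ∪ ⋃_{q∈Q} Rng(b⁽q⁾); by domain independence D
-- may be evaluated in these domains instead of B.  Given an assignment x⃗ into
-- the smaller domain, let K be the finitely many blocks used by x⃗ and fix
-- q₀ ∈ Q.  Fixing A and the blocks in K, and sending every other block
-- b⁽q⁾ position by position onto b⁽q₀⁾, is well defined: a point shared by A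
-- and a block, or by two blocks, lies in a⃗, and by (3) an entry of a⃗ sits at
-- the same position in every block.  This map is a homomorphism fixing x⃗
-- from S to T over these domains; since T ⊆ S the body of D holds at x⃗ in S, and
-- the map carries a witness of a disjunct in S to one in T.
module Submission where

open import Defs
open import Data.Nat using (ℕ; _≤_; _≟_)
open import Data.Fin using (Fin; combine; remQuot; _↑ˡ_; _↑ʳ_)
open import Data.Fin.Properties using (combine-remQuot; any?)
open import Data.Vec using (Vec; lookup; concat; _++_; map)
open import Data.Vec.Properties using (lookup-concat; lookup-map; lookup-++ˡ; lookup-++ʳ)
open import Data.Vec.Relation.Binary.Pointwise.Extensional using (Pointwise; ext; Pointwise-≡⇒≡)
open import Data.Product using (Σ; ∃; ∃₂; _×_; _,_; proj₁; proj₂)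
open import Data.Sum using (_⊎_; inj₁; inj₂)
open import Data.Empty using (⊥)
import Data.List.Relation.Unary.All as All
import Data.List.Relation.Unary.Any as Any
open import Relation.Binary.PropositionalEquality using (_≡_; _≢_; refl; sym; trans; cong; subst; subst₂)
open import Relation.Nullary using (¬_; yes; no)
open import Relation.Unary using (Decidable)
open import Function.Base using (id)
open import Function.Bundles using (Equivalence)

-- Membership in M is not decidable, so the homomorphism is a functional
-- relation: the image of u is chosen from a proof of M u.
record Homomorphism {k : ℕ} {U : Set} (M : Pred U) (S : Pred (Vec U k))
                    (N : Pred U) (T : Pred (Vec U k)) : Set₁ where
  field
    _↦_        : U → U → Set
    image      : ∀ {u} → M u → Σ U λ u' → u ↦ u' × N u'
    functional : ∀ {u v v'} → u ↦ v → u ↦ v' → v ≡ v'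
    preserves  : ∀ {t t'} → Pointwise _↦_ t t' → S t → T t'

HomomorphismFixing : {k : ℕ} {U : Set} → Pred U → Pred (Vec U k) → Pred U → Pred (Vec U k) →
                     {nx : ℕ} → (Fin nx → U) → Set₁
HomomorphismFixing M S N T x =
  Σ (Homomorphism M S N T) λ h → ∀ i → Homomorphism._↦_ h (x i) (x i)

module _ {k : ℕ} {U V : Set} where

  holdsAtom-mono : {S T : Pred (Vec U k)} → (∀ t → S t → T t) →
                   (s : V → U) (α : Atom k V) → HoldsAtom S s α → HoldsAtom T s α
  holdsAtom-mono S⊆T s (rel z)  = S⊆T (map s z)
  holdsAtom-mono S⊆T s (eq v w) = id

  holdsAtom-hom : {M N : Pred U} {S T : Pred (Vec U k)} (h : Homomorphism M S N T) {s s' : V → U} →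
                  (∀ v → Homomorphism._↦_ h (s v) (s' v)) →
                  (α : Atom k V) → HoldsAtom S s α → HoldsAtom T s' α
  holdsAtom-hom h {s} {s'} s↦s' (rel z) =
    preserves (ext λ j → subst₂ _↦_ (sym (lookup-map j s z)) (sym (lookup-map j s' z)) (s↦s' (lookup z j)))
    where open Homomorphism h
  holdsAtom-hom h s↦s' (eq v w) sv≡sw =
    functional (s↦s' v) (subst (_↦ _) (sym sv≡sw) (s↦s' w))
    where open Homomorphism h

sat-retract : {k : ℕ} {U : Set} {M N : Pred U} {S T : Pred (Vec U k)} (D : DED k) →
  Sat U M S D → (∀ t → T t → S t) → (∀ u → N u → M u) →
  ((x : Fin (DED.nx D) → U) → (∀ i → N (x i)) → HomomorphismFixing M S N T x) →
  Sat U N T D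
sat-retract {U = U} {M} {N} {S} {T} D satS T⊆S N⊆M retraction x xN φ =
  Any.map transfer (satS x (λ i → N⊆M (x i) (xN i)) (All.map (λ {α} → holdsAtom-mono T⊆S x α) φ))
  where
    h : Homomorphism M S N T
    h = proj₁ (retraction x xN)
    open Homomorphism h

    transfer : ∀ {d} →
      (Σ (Fin (Disjunct.ny d) → U) λ y → (∀ j → M (y j)) × HoldsConj S [ x , y ] (Disjunct.psi d)) →
      (Σ (Fin (Disjunct.ny d) → U) λ y → (∀ j → N (y j)) × HoldsConj T [ x , y ] (Disjunct.psi d))
    transfer (y , yM , ψ) = y' , (λ j → proj₂ (proj₂ (image (yM j)))) , All.map (λ {α} → holdsAtom-hom h related α) ψ
      where
        y' : Fin _ → U
        y' j = proj₁ (image (yM j))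

        related : ∀ v → [ x , y ] v ↦ [ x , y' ] v
        related (inj₁ i) = proj₂ (retraction x xN) i
        related (inj₂ j) = proj₁ (proj₂ (image (yM j)))

AddTuples-entries : {U : Set} {k n : ℕ} {R : Pred (Vec U k)} {b : ℕ → Vec (Vec U k) n} {P : Pred ℕ}
  (X : Pred U) → (∀ t → R t → ∀ j → X (lookup t j)) →
  (∀ q → P q → ∀ i j → X (lookup (lookup (b q) i) j)) →
  ∀ t → AddTuples R b P t → ∀ j → X (lookup t j)
AddTuples-entries X R⊆X b⊆X t (inj₁ Rt) j                = R⊆X t Rt j
AddTuples-entries X R⊆X b⊆X t (inj₂ (q , Pq , i , refl)) j = b⊆X q Pq i j

module Blocks {U : Set} (A : Pred U) {N m : ℕ} (c : ℕ → Vec U N) (a : Vec U m)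
  (A-disjoint : ∀ q → DisjointFromExceptOn (c q) A a)
  (blocks-disjoint : ∀ q q' → q ≢ q' → DisjointExceptOn (c q) (c q') a)
  (same-type : ∀ q q' → SameIdType (c q ++ a) (c q' ++ a)) where

  Dom : Pred ℕ → Pred U
  Dom P u = A u ⊎ ∃ λ q → P q × Rng (c q) u

  Dom-mono : ∀ {P P'} → (∀ {q} → P q → P' q) → ∀ u → Dom P u → Dom P' u
  Dom-mono P⊆P' u (inj₁ Au)           = inj₁ Au
  Dom-mono P⊆P' u (inj₂ (q , Pq , r)) = inj₂ (q , P⊆P' Pq , r)

  ViaBlock : ∀ {P u} → Dom P u → Pred ℕ
  ViaBlock (inj₁ _)        q = ⊥
  ViaBlock (inj₂ (q' , _)) q = q' ≡ q

  viaBlock? : ∀ {P u} (d : Dom P u) → Decidable (ViaBlock d)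
  viaBlock? (inj₁ _)        q = no λ ()
  viaBlock? (inj₂ (q' , _)) q = q' ≟ q

  viaBlock⇒P : ∀ {P u} (d : Dom P u) → ∀ {q} → ViaBlock d q → P q
  viaBlock⇒P (inj₂ (_ , Pq , _)) refl = Pq

  dom-via : ∀ {P K u} (d : Dom P u) → (∀ {q} → ViaBlock d q → K q) → Dom K u
  dom-via (inj₁ Au)          _ = inj₁ Au
  dom-via (inj₂ (q , _ , r)) K⊇ = inj₂ (q , K⊇ refl , r)

  transport : ∀ q q' {p p'} → lookup (c q) p ≡ lookup (c q) p' → lookup (c q') p ≡ lookup (c q') p'
  transport q q' {p} {p'} e =
    subst₂ _≡_ (lookup-++ˡ (c q') a p) (lookup-++ˡ (c q') a p')
      (Equivalence.to (same-type q q' (p ↑ˡ m) (p' ↑ˡ m))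
        (subst₂ _≡_ (sym (lookup-++ˡ (c q) a p)) (sym (lookup-++ˡ (c q) a p')) e))

  anchor : ∀ q q' {p u} → lookup (c q) p ≡ u → Rng a u → lookup (c q') p ≡ u
  anchor q q' {p} e (r , aᵣ≡u) =
    trans (subst₂ _≡_ (lookup-++ˡ (c q') a p) (lookup-++ʳ (c q') a r)
            (Equivalence.to (same-type q q' (p ↑ˡ m) (N ↑ʳ r))
              (subst₂ _≡_ (sym (lookup-++ˡ (c q) a p)) (sym (lookup-++ʳ (c q) a r)) (trans e (sym aᵣ≡u)))))
          aᵣ≡u

  module Collapse (K : Pred ℕ) (K? : Decidable K) (q₀ : ℕ) where

    _↦_ : U → U → Set
    u ↦ u' = (Dom K u × u' ≡ u) ⊎ (∃₂ λ q p → ¬ K q × lookup (c q) p ≡ u × u' ≡ lookup (c q₀) p)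

    fixed-shared : ∀ {u q p} → Dom K u → ¬ K q → lookup (c q) p ≡ u → Rng a u
    fixed-shared {u} {q} {p} (inj₁ Au) _ e = A-disjoint q u (p , e) Au
    fixed-shared {u} {q} {p} (inj₂ (q' , Kq' , r)) ¬Kq e =
      blocks-disjoint q' q (λ { refl → ¬Kq Kq' }) u r (p , e)

    fixed : ∀ {u u'} → u ↦ u' → Dom K u → u' ≡ u
    fixed (inj₁ (_ , u'≡u)) _ = u'≡u
    fixed (inj₂ (q , p , ¬Kq , e , u'≡)) κ = trans u'≡ (anchor q q₀ e (fixed-shared κ ¬Kq e))

    fixed-tuple : ∀ {n} {t t' : Vec U n} → Pointwise _↦_ t t' → (∀ j → Dom K (lookup t j)) → t' ≡ t
    fixed-tuple (ext t↦t') κ = Pointwise-≡⇒≡ (ext λ j → fixed (t↦t' j) (κ j))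

    moved : ∀ {u u' q p} → u ↦ u' → ¬ K q → lookup (c q) p ≡ u → u' ≡ lookup (c q₀) p
    moved {q = q} (inj₁ (κ , u'≡u)) ¬Kq e = trans u'≡u (sym (anchor q q₀ e (fixed-shared κ ¬Kq e)))
    moved {u} {q = q} {p} (inj₂ (q' , p' , _ , e' , u'≡)) ¬Kq e with q' ≟ q
    ... | yes refl = trans u'≡ (transport q q₀ (trans e' (sym e)))
    ... | no q'≢q  = trans u'≡ (trans (anchor q' q₀ e' shared) (sym (anchor q q₀ e shared)))
      where
        shared : Rng a u
        shared = blocks-disjoint q' q q'≢q u (p' , e') (p , e)

    functional : ∀ {u v v'} → u ↦ v → u ↦ v' → v ≡ v'
    functional u↦v (inj₁ (κ , v'≡u))          = trans (fixed u↦v κ) (sym v'≡u)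
    functional u↦v (inj₂ (_ , _ , ¬Kq , e , v'≡)) = trans (moved u↦v ¬Kq e) (sym v'≡)

    image : ∀ {P u} → Dom P u → Σ U λ u' → u ↦ u' × (Dom K u' ⊎ Rng (c q₀) u')
    image {u = u} (inj₁ Au) = u , inj₁ (inj₁ Au , refl) , inj₁ (inj₁ Au)
    image {u = u} (inj₂ (q , _ , p , e)) with K? q
    ... | yes Kq = u , inj₁ (κ , refl) , inj₁ κ
      where
        κ : Dom K u
        κ = inj₂ (q , Kq , p , e)
    ... | no ¬Kq = lookup (c q₀) p , inj₂ (q , p , ¬Kq , e , refl) , inj₂ (p , refl)

Rng-concat⁻ : {U : Set} {n k : ℕ} (v : Vec (Vec U k) n) {u : U} → Rng (concat v) u → ∃ λ i → Rng (lookup v i) u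
Rng-concat⁻ {n = n} {k} v (p , e) =
  i , j , trans (sym (lookup-concat v i j)) (trans (cong (lookup (concat v)) (combine-remQuot {n} k p)) e)
  where
    i : Fin n
    i = proj₁ (remQuot {n} k p)
    j : Fin k
    j = proj₂ (remQuot {n} k p)

lookup-concat-at : {U : Set} {n k : ℕ} (v : Vec (Vec U k) n) {i : Fin n} {t : Vec U k} →
  t ≡ lookup v i → ∀ j → lookup (concat v) (combine i j) ≡ lookup t j
lookup-concat-at v refl j = lookup-concat v _ j

module CollapseTuples {U : Set} {k n : ℕ} (A : Pred U) (R : Pred (Vec U k))
  (R⊆Aᵏ : ∀ t → R t → ∀ j → A (lookup t j))
  (b : ℕ → Vec (Vec U k) n) {m : ℕ} (a : Vec U m)
  (b-disjoint-A : ∀ q i → DisjointFromExceptOn (lookup (b q) i) A a)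
  (blocks-disjoint : ∀ q q' → q ≢ q' → DisjointExceptOn (concat (b q)) (concat (b q')) a)
  (same-type : ∀ q q' → SameIdType (concat (b q) ++ a) (concat (b q') ++ a))
  (Q : Pred ℕ) {q₀ : ℕ} (Qq₀ : Q q₀) where

  open Blocks A (λ q → concat (b q)) a
    (λ q u r → b-disjoint-A q (proj₁ (Rng-concat⁻ (b q) r)) u (proj₂ (Rng-concat⁻ (b q) r)))
    blocks-disjoint same-type public

  AddTuples-Dom : ∀ {P} t → AddTuples R b P t → ∀ j → Dom P (lookup t j)
  AddTuples-Dom {P} = AddTuples-entries {b = b} (Dom P) (λ t Rt j → inj₁ (R⊆Aᵏ t Rt j))
    (λ q Pq i j → inj₂ (q , Pq , combine i j , lookup-concat (b q) i j))

  collapse : (S : Pred (Vec U k)) → (∀ t → S t → AddTuples R b Allℕ t) →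
    (K : Pred ℕ) → Decidable K → (∀ {q} → K q → Q q) →
    Homomorphism (Dom Allℕ) S (Dom Q) (AddTuples R b Q)
  collapse S S⊆R+b K K? K⊆Q = record
    { _↦_        = _↦_
    ; image      = λ d → let u' , u↦u' , d' = image d in u' , u↦u' , into-Q d'
    ; functional = functional
    ; preserves  = λ t↦t' St → preserves t↦t' (S⊆R+b _ St)
    }
    where
      open Collapse K K? q₀

      into-Q : ∀ {u} → Dom K u ⊎ Rng (concat (b q₀)) u → Dom Q u
      into-Q (inj₁ κ) = Dom-mono K⊆Q _ κ
      into-Q (inj₂ r) = inj₂ (q₀ , Qq₀ , r)

      preserves : ∀ {t t'} → Pointwise _↦_ t t' → AddTuples R b Allℕ t → AddTuples R b Q t'
      preserves {t} t↦t' (inj₁ Rt) =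
        inj₁ (subst R (sym (fixed-tuple t↦t' λ j → inj₁ (R⊆Aᵏ t Rt j))) Rt)
      preserves t↦t' (inj₂ (q , _ , i , t≡bqi)) with K? q
      ... | yes Kq = inj₂ (q , K⊆Q Kq , i ,
              trans (fixed-tuple t↦t' λ j → inj₂ (q , Kq , combine i j , lookup-concat-at (b q) t≡bqi j)) t≡bqi)
      ... | no ¬Kq = inj₂ (q₀ , Qq₀ , i , Pointwise-≡⇒≡ (ext λ j →
              trans (moved (Pointwise.app t↦t' j) ¬Kq (lookup-concat-at (b q) t≡bqi j)) (lookup-concat (b q₀) i j)))

  -- x⃗ passes through finitely many blocks, so K is decidable.
  retraction : (S : Pred (Vec U k)) → (∀ t → S t → AddTuples R b Allℕ t) →
    {nx : ℕ} (x : Fin nx → U) → (∀ i → Dom Q (x i)) →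
    HomomorphismFixing (Dom Allℕ) S (Dom Q) (AddTuples R b Q) x
  retraction S S⊆R+b x xQ =
    collapse S S⊆R+b K (λ q → any? λ i → viaBlock? (xQ i) q) (λ { (i , via) → viaBlock⇒P (xQ i) via }) ,
    λ i → inj₁ (dom-via (xQ i) (λ via → i , via) , refl)
    where
      K : Pred ℕ
      K q = ∃ λ i → ViaBlock (xQ i) q

corollary1 : {k : ℕ} (D : DED k) → DomainIndependent D →
    (U : Set) (A B : Pred U) (R : Pred (Vec U k)) →
    (∀ t → R t → ∀ j → A (lookup t j)) →
    (∀ u → A u → B u) →
    (n : ℕ) → 1 ≤ n →
    (b : ℕ → Vec (Vec U k) n) →
    (∀ q i → (∀ j → B (lookup (lookup (b q) i) j)) × ¬ (∀ j → A (lookup (lookup (b q) i) j))) →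
    {m : ℕ} (a : Vec U m) →
    Lists a (λ u → A u × ∃ λ i → Rng (lookup (b 1) i) u) →
    (∀ q i → DisjointFromExceptOn (lookup (b q) i) A a) →
    (∀ q q' → q ≢ q' → DisjointExceptOn (concat (b q)) (concat (b q')) a) →
    (∀ q q' → SameIdType (concat (b q) ++ a) (concat (b q') ++ a)) →
    (S : Pred (Vec U k)) →
    Sat U B S D →
    (∀ t → R t → S t) →
    (∀ t → S t → AddTuples R b Allℕ t) →
    (Q : Pred ℕ) → (∃ λ q → Q q) →
    (∀ q → Q q → ∀ i → S (lookup (b q) i)) →
    Sat U B (AddTuples R b Q) D
corollary1 D DI U A B R R⊆Aᵏ A⊆B _ _ b b-tuples a _ b-disjoint-A blocks-disjoint same-type
           S satS R⊆S S⊆R+b Q (_ , Qq₀) b⊆S =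
  Equivalence.to (DI U (Dom Q) B T AddTuples-Dom in-B)
    (sat-retract D satS-Dom T⊆S (Dom-mono _) (retraction S S⊆R+b))
  where
    open CollapseTuples A R R⊆Aᵏ b a b-disjoint-A blocks-disjoint same-type Q Qq₀

    T : Pred (Vec U _)
    T = AddTuples R b Q

    in-B : ∀ {P} t → AddTuples R b P t → ∀ j → B (lookup t j)
    in-B = AddTuples-entries {b = b} B (λ t Rt j → A⊆B _ (R⊆Aᵏ t Rt j)) (λ q _ i → proj₁ (b-tuples q i))

    T⊆S : ∀ t → T t → S t
    T⊆S t (inj₁ Rt)                = R⊆S t Rt
    T⊆S t (inj₂ (q , Qq , i , refl)) = b⊆S q Qq i

    satS-Dom : Sat U (Dom Allℕ) S D
    satS-Dom = Equivalence.to
      (DI U B (Dom Allℕ) S (λ t St → in-B t (S⊆R+b t St)) (λ t St → AddTuples-Dom t (S⊆R+b t St))) satS
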